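{- Let $G=(V,E)$ be a strongly connected finite directed multigraph equipped with a deadlock-free routing, and let $E=(e_1,\dots,e_m)$ be a total ordering of its edges consistent with the dependencies of this routing (i.e. whenever there is a dependency from $e_i$ to $e_j$, we have $i<j$). Let $s$ be the attraction number of this ordering and $G_s=(V,\{e_1,\dots,e_s\})$ its attraction subgraph. If $G_s$ has exactly one global attractor $v$, then $G$ contains two edge-disjoint spanning directed trees rooted at $v$, one directed into $v$ (every vertex has a directed path to $v$ within the tree) and the other directed away from $v$ (every vertex is reachable from $v$ within the tree).
   Context: A routing for $G$ assigns, deterministically, to each ordered pair $(a,b)$ of distinct vertices a directed path from $a$ to $b$. There is a dependency from edge $e$ to edge $e'$ if some routing path uses $e'$ immediately after $e$; the dependency graph has vertex set $E$ and these dependencies as edges. The routing is deadlock-free if its dependency graph is acyclic. Parallel edges are considered distinct. A vertex of a directed graph is a global attractor if it is reachable from all other vertices. Given the total ordering $(e_1,\dots,e_m)$ of $E$, the attraction number $s$ is the smallest integer such that some vertex of $V$ is reachable from all other vertices using only edges in $\{e_1,\dots,e_s\}$ (reachability here is along arbitrary directed paths in that edge set, not required to respect the ordering). The attraction subgraph is $G_s=(V,\{e_1,\dots,e_s\})$. -}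

module Defs where

open import Data.Nat using (ℕ; _<_)
open import Data.Fin using (Fin; toℕ)
open import Data.Fin.Subset using (Subset; _∈_; _∉_)
open import Data.Product using (Σ; ∃; _×_; ∃-syntax)
open import Data.Unit using (⊤)
open import Relation.Binary.PropositionalEquality using (_≡_; _≢_)
open import Relation.Nullary using (¬_)
open import Relation.Binary.Construct.Closure.Transitive using (TransClosure)

-- A finite directed multigraph: vertices Fin n, edges Fin m (parallel edges
-- are distinct edge indices). The edge index order e₁ < … < eₘ is the given
-- total ordering of E.
record Multigraph : Set where
  field
    n m : ℕ
    src tgt : Fin m → Fin n

module _ (G : Multigraph) where
  open Multigraph G

  V = Fin n
  E = Fin m

  data Path : V → V → Set where
    []  : ∀ {a} → Path a a
    _∷⟨_⟩_ : ∀ {a b} (e : E) → src e ≡ a → Path (tgt e) b → Path a b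

  data Within (S : E → Set) : ∀ {a b} → Path a b → Set where
    []  : ∀ {a} → Within S ([] {a})
    _∷_ : ∀ {a b e} {p : src e ≡ a} {q : Path (tgt e) b} →
          S e → Within S q → Within S (e ∷⟨ p ⟩ q)

  Reach : (E → Set) → V → V → Set
  Reach S a b = Σ (Path a b) (Within S)

  StronglyConnected : Set
  StronglyConnected = ∀ a b → Reach (λ _ → ⊤) a b

  data Consec : ∀ {a b} → Path a b → E → E → Set where
    here  : ∀ {a b e e'} {p : src e ≡ a} {p' : src e' ≡ tgt e} {q : Path (tgt e') b} →
            Consec (e ∷⟨ p ⟩ (e' ∷⟨ p' ⟩ q)) e e'
    there : ∀ {a b e x y} {p : src e ≡ a} {q : Path (tgt e) b} →
            Consec q x y → Consec (e ∷⟨ p ⟩ q) x y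

  Routing : Set
  Routing = (a b : V) → a ≢ b → Path a b

  Dep : Routing → E → E → Set
  Dep R e e' = ∃[ a ] ∃[ b ] Σ (a ≢ b) λ ne → Consec (R a b ne) e e'

  DeadlockFree : Routing → Set
  DeadlockFree R = ∀ e → ¬ TransClosure (Dep R) e e

  Consistent : Routing → Set
  Consistent R = ∀ e e' → Dep R e e' → toℕ e < toℕ e'

  Prefix : ℕ → E → Set
  Prefix s e = toℕ e < s

  GlobalAttractor : (E → Set) → V → Set
  GlobalAttractor S v = ∀ u → Reach S u v

  IsAttractionNumber : ℕ → Set
  IsAttractionNumber s =
    (∃[ v ] GlobalAttractor (Prefix s) v) ×
    (∀ t → t < s → ¬ (∃[ v ] GlobalAttractor (Prefix t) v))

  InTree : Subset m → V → Set
  InTree T v =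
    (∀ e → e ∈ T → src e ≢ v) ×
    (∀ u → u ≢ v → ∃[ e ] (e ∈ T × src e ≡ u × (∀ e' → e' ∈ T → src e' ≡ u → e' ≡ e))) ×
    (∀ u → Reach (_∈ T) u v)

  OutTree : Subset m → V → Set
  OutTree T v =
    (∀ e → e ∈ T → tgt e ≢ v) ×
    (∀ u → u ≢ v → ∃[ e ] (e ∈ T × tgt e ≡ u × (∀ e' → e' ∈ T → tgt e' ≡ u → e' ≡ e))) ×
    (∀ u → Reach (_∈ T) v u)

  EdgeDisjoint : Subset m → Subset m → Set
  EdgeDisjoint T₁ T₂ = ∀ e → e ∈ T₁ → e ∉ T₂

{-# OPTIONS --safe #-}
-- A prefix edge leaving v must return to v: otherwise its head would be a
-- second global attractor of G_s. Routing paths follow the dependencies, so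
-- their edge indices increase; hence the routing path from v to any u, once
-- past its initial loops at v, uses only edges of index ≥ s. So v reaches
-- every vertex along edges of index ≥ s while every vertex reaches v in G_s,
-- and breadth-first search trees in these two disjoint edge sets are the
-- required arborescences.
module Submission where

open import Defs
open import Data.Nat using (ℕ; zero; suc; _<_; _≤_; z≤n; s≤s; _<?_; _≤?_)
open import Data.Nat.Properties using (≮⇒≥; ≤-refl; ≤-trans; <⇒≤; <⇒≱)
open import Data.Nat.Induction using (<-wellFounded)
open import Data.Fin using (Fin; toℕ; _≟_)
open import Data.Fin.Properties using (any?)
open import Data.Fin.Subset using (Subset; _∈_)
open import Data.Vec using (tabulate)
open import Data.Vec.Properties using ([]=⇒lookup; lookup⇒[]=; lookup∘tabulate)
open import Data.Product using (∃; ∃-syntax; _×_; _,_; proj₁)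
open import Data.Sum using (_⊎_; inj₁; inj₂)
open import Data.Empty using (⊥-elim)
open import Data.Maybe using (Maybe; just; nothing)
open import Data.Maybe.Properties using (just-injective) renaming (≡-dec to ≡-dec-Maybe)
open import Function using (_∘_; _on_)
open import Induction.WellFounded using (Acc; acc)
open import Relation.Binary.Construct.On using (wellFounded)
open import Relation.Binary.PropositionalEquality using (_≡_; _≢_; refl; sym; trans; subst)
open import Relation.Nullary using (¬_; Dec; yes; no; does)
open import Relation.Nullary.Decidable using (dec-true; _×-dec_; _⊎-dec_)
open import Relation.Unary using (Decidable)

module _ {n : ℕ} {P : Fin n → Set} (P? : Decidable P) where

  toSubset : Subset n
  toSubset = tabulate (does ∘ P?)

  ∈-toSubset⁺ : ∀ {i} → P i → i ∈ toSubset
  ∈-toSubset⁺ {i} pi =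
    lookup⇒[]= i toSubset (trans (lookup∘tabulate _ i) (dec-true (P? i) pi))

  ∈-toSubset⁻ : ∀ {i} → i ∈ toSubset → P i
  ∈-toSubset⁻ {i} i∈
    with P? i | trans (sym (lookup∘tabulate (does ∘ P?) i)) ([]=⇒lookup i∈)
  ... | yes pi | _ = pi
  ... | no _   | ()

least : {P : ℕ → Set} → (∀ k → Dec (P k)) →
        ∀ k → P k → ∃[ k ] (P k × (∀ j → j < k → ¬ P j))
least P? zero p = zero , p , λ _ ()
least P? (suc k) p with P? zero
... | yes p₀ = zero , p₀ , λ _ ()
... | no ¬p₀ with least (P? ∘ suc) k p
...   | j , pj , below = suc j , pj , λ { zero _ → ¬p₀ ; (suc i) (s≤s i<j) → below i i<j }

module _ (G : Multigraph) where
  open Multigraph G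

  Reach-∷ʳ : ∀ {S : E G → Set} {a b c e} →
             Reach G S a b → S e → src e ≡ b → tgt e ≡ c → Reach G S a c
  Reach-∷ʳ {e = e} ([] , []) se p refl = (e ∷⟨ p ⟩ []) , (se ∷ [])
  Reach-∷ʳ ((e′ ∷⟨ p′ ⟩ q) , (se′ ∷ w)) se p r
    with q′ , w′ ← Reach-∷ʳ (q , w) se p r = (e′ ∷⟨ p′ ⟩ q′) , (se′ ∷ w′)

reverse : Multigraph → Multigraph
reverse G = record { n = n ; m = m ; src = tgt ; tgt = src }
  where open Multigraph G

Reach-reverse : ∀ G {S : E G → Set} {a b} → Reach G S a b → Reach (reverse G) S b a
Reach-reverse G ([] , []) = [] , []
Reach-reverse G ((e ∷⟨ p ⟩ q) , (se ∷ w)) =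
  Reach-∷ʳ (reverse G) (Reach-reverse G (q , w)) se refl p

OutTree-reverse⇒InTree : ∀ G {T v} → OutTree (reverse G) T v → InTree G T v
OutTree-reverse⇒InTree G (root , parent , reach) =
  root , parent , Reach-reverse (reverse G) ∘ reach

module _ (G : Multigraph) where
  open Multigraph G

  module ParentTree (S : E G → Set) (r : V G)
                    (rank : V G → ℕ) (parent : V G → Maybe (E G))
                    (parent-just : ∀ {u e} → parent u ≡ just e →
                                   S e × tgt e ≡ u × rank (src e) < rank u)
                    (parent-nothing : ∀ {u} → parent u ≡ nothing → u ≡ r)
                    (parent-root : parent r ≡ nothing) where

    parent-edge? : Decidable (λ e → parent (tgt e) ≡ just e)
    parent-edge? e = ≡-dec-Maybe _≟_ (parent (tgt e)) (just e)

    tree : Subset m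
    tree = toSubset parent-edge?

    tree-parent : ∀ {e} → e ∈ tree → parent (tgt e) ≡ just e
    tree-parent = ∈-toSubset⁻ parent-edge?

    tree⊆S : ∀ {e} → e ∈ tree → S e
    tree⊆S = proj₁ ∘ parent-just ∘ tree-parent

    parent∈tree : ∀ {u e} → parent u ≡ just e → e ∈ tree
    parent∈tree eq with _ , refl , _ ← parent-just eq = ∈-toSubset⁺ parent-edge? eq

    tree-avoids-root : ∀ {e} → e ∈ tree → tgt e ≢ r
    tree-avoids-root e∈ refl with () ← trans (sym parent-root) (tree-parent e∈)

    tree-edge-unique : ∀ {u e e′} → e′ ∈ tree → tgt e′ ≡ u → parent u ≡ just e → e′ ≡ e
    tree-edge-unique e′∈ refl eq = just-injective (trans (sym (tree-parent e′∈)) eq)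

    tree-edge-into : ∀ u → u ≢ r →
                     ∃[ e ] (e ∈ tree × tgt e ≡ u × (∀ e′ → e′ ∈ tree → tgt e′ ≡ u → e′ ≡ e))
    tree-edge-into u u≢r with parent u in eq
    ... | nothing = ⊥-elim (u≢r (parent-nothing eq))
    ... | just e with _ , te , _ ← parent-just eq =
      e , parent∈tree eq , te , λ e′ e′∈ te′ → tree-edge-unique e′∈ te′ eq

    root-reaches : ∀ u → Acc (_<_ on rank) u → Reach G (_∈ tree) r u
    root-reaches u (acc rec) with parent u in eq
    ... | nothing = subst (Reach G (_∈ tree) r) (sym (parent-nothing eq)) ([] , [])
    ... | just e with _ , te , below ← parent-just eq =
      Reach-∷ʳ G (root-reaches (src e) (rec below)) (parent∈tree eq) refl te

    out-tree : OutTree G tree r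
    out-tree = (λ _ → tree-avoids-root) , tree-edge-into ,
               λ u → root-reaches u (wellFounded rank <-wellFounded u)

  module BreadthFirstSearch {S : E G → Set} (S? : Decidable S) (r : V G) where

    ReachIn : ℕ → V G → Set
    ReachIn zero    u = u ≡ r
    ReachIn (suc k) u = ReachIn k u ⊎ ∃[ e ] (S e × ReachIn k (src e) × tgt e ≡ u)

    reachIn? : ∀ k u → Dec (ReachIn k u)
    reachIn? zero    u = u ≟ r
    reachIn? (suc k) u =
      reachIn? k u ⊎-dec any? (λ e → S? e ×-dec reachIn? k (src e) ×-dec tgt e ≟ u)

    ReachIn-extend : ∀ {k a b} → ReachIn k a → Reach G S a b → ∃[ j ] ReachIn j b
    ReachIn-extend {k} ra ([] , []) = k , ra
    ReachIn-extend {k} ra ((e ∷⟨ p ⟩ q) , (se ∷ w)) =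
      ReachIn-extend (inj₂ (e , se , subst (ReachIn k) (sym p) ra , refl)) (q , w)

    IsDistance : V G → ℕ → Set
    IsDistance u k = ReachIn k u × (∀ j → j < k → ¬ ReachIn j u)

    module _ (reach : ∀ u → Reach G S r u) where

      distance : ∀ u → ∃ (IsDistance u)
      distance u = let k , rk = ReachIn-extend refl (reach u) in least (λ j → reachIn? j u) k rk

      dist : V G → ℕ
      dist u = proj₁ (distance u)

      dist-minimal : ∀ {k u} → ReachIn k u → dist u ≤ k
      dist-minimal {k} {u} rk with distance u
      ... | _ , _ , below = ≮⇒≥ (λ k<d → below k k<d rk)

      parentOf : ∀ {u} → ∃ (IsDistance u) → Maybe (E G)
      parentOf (zero  , _)                = nothing
      parentOf (suc _ , inj₁ _ , _)       = nothing
      parentOf (suc _ , inj₂ (e , _) , _) = just e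

      parent : V G → Maybe (E G)
      parent u = parentOf (distance u)

      parent-just : ∀ {u e} → parent u ≡ just e → S e × tgt e ≡ u × dist (src e) < dist u
      parent-just {u} eq with distance u
      parent-just ()   | zero  , _
      parent-just ()   | suc _ , inj₁ _ , _
      parent-just refl | suc _ , inj₂ (_ , se , rk , te) , _ = se , te , s≤s (dist-minimal rk)

      parent-nothing : ∀ {u} → parent u ≡ nothing → u ≡ r
      parent-nothing {u} eq with distance u
      parent-nothing _  | zero  , u≡r , _         = u≡r
      parent-nothing _  | suc k , inj₁ rk , below = ⊥-elim (below k ≤-refl rk)
      parent-nothing () | suc _ , inj₂ _ , _

      parent-root : parent r ≡ nothing
      parent-root with distance r
      ... | zero  , _         = refl
      ... | suc _ , _ , below = ⊥-elim (below zero (s≤s z≤n) refl)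

spanning-out-tree : ∀ G {S : E G → Set} → Decidable S → ∀ r → (∀ u → Reach G S r u) →
                    ∃[ T ] (OutTree G T r × (∀ {e} → e ∈ T → S e))
spanning-out-tree G {S} S? r reach = tree , out-tree , tree⊆S
  where
  open BreadthFirstSearch G S? r
  open ParentTree G S r (dist reach) (parent reach) (parent-just reach)
                  (parent-nothing reach) (parent-root reach)

spanning-in-tree : ∀ G {S : E G → Set} → Decidable S → ∀ r → (∀ u → Reach G S u r) →
                   ∃[ T ] (InTree G T r × (∀ {e} → e ∈ T → S e))
spanning-in-tree G S? r reach =
  let T , out-tree , T⊆S = spanning-out-tree (reverse G) S? r (Reach-reverse G ∘ reach)
  in T , OutTree-reverse⇒InTree G out-tree , T⊆S

module _ (G : Multigraph) where
  open Multigraph G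

  Suffix : ℕ → E G → Set
  Suffix s e = s ≤ toℕ e

  Increasing : ∀ {a b} → Path G a b → Set
  Increasing q = ∀ x y → Consec G q x y → toℕ x < toℕ y

  Increasing-tail : ∀ {a b e} {p : src e ≡ a} {q : Path G (tgt e) b} →
                    Increasing (e ∷⟨ p ⟩ q) → Increasing q
  Increasing-tail inc x y c = inc x y (there c)

  routing-increasing : ∀ {R} → Consistent G R → ∀ a b (a≢b : a ≢ b) → Increasing (R a b a≢b)
  routing-increasing consistent a b a≢b x y c = consistent x y (a , b , a≢b , c)

  increasing-stays-in-Suffix : ∀ {s a b e} {p : src e ≡ a} (q : Path G (tgt e) b) →
                               Increasing (e ∷⟨ p ⟩ q) → Suffix s e →
                               Within G (Suffix s) (e ∷⟨ p ⟩ q)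
  increasing-stays-in-Suffix []            _   se = se ∷ []
  increasing-stays-in-Suffix (_ ∷⟨ _ ⟩ q) inc se =
    se ∷ increasing-stays-in-Suffix q (Increasing-tail inc) (≤-trans se (<⇒≤ (inc _ _ here)))

  increasing-Reach-Suffix : ∀ {s v} → (∀ e → src e ≡ v → Prefix G s e → tgt e ≡ v) →
                            ∀ {a b} → a ≡ v → (q : Path G a b) → Increasing q →
                            Reach G (Suffix s) a b
  increasing-Reach-Suffix loops a≡v [] _ = [] , []
  increasing-Reach-Suffix {s} loops a≡v (e ∷⟨ p ⟩ q) inc with toℕ e <? s
  ... | yes e<s = let e-loops = loops e (trans p a≡v) e<s in
                  subst (λ x → Reach G (Suffix s) x _) (trans e-loops (sym a≡v))
                        (increasing-Reach-Suffix loops e-loops q (Increasing-tail inc))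
  ... | no  e≮s = (e ∷⟨ p ⟩ q) , increasing-stays-in-Suffix q inc (≮⇒≥ e≮s)

  module _ {s v} (attractor : GlobalAttractor G (Prefix G s) v)
           (unique : ∀ w → GlobalAttractor G (Prefix G s) w → w ≡ v) where

    unique-attractor-Prefix-loops : ∀ e → src e ≡ v → Prefix G s e → tgt e ≡ v
    unique-attractor-Prefix-loops e src≡v e<s =
      unique (tgt e) (λ u → Reach-∷ʳ G (attractor u) e<s src≡v refl)

    unique-attractor-Reach-Suffix : ∀ {R} → Consistent G R → ∀ u → Reach G (Suffix s) v u
    unique-attractor-Reach-Suffix {R} consistent u with v ≟ u
    ... | yes refl = [] , []
    ... | no  v≢u  = increasing-Reach-Suffix unique-attractor-Prefix-loops refl
                       (R v u v≢u) (routing-increasing consistent v u v≢u)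

lemma1 : (G : Multigraph) → StronglyConnected G →
         (R : Routing G) → DeadlockFree G R → Consistent G R →
         (s : ℕ) → IsAttractionNumber G s →
         (v : V G) → GlobalAttractor G (Prefix G s) v →
         (∀ w → GlobalAttractor G (Prefix G s) w → w ≡ v) →
         ∃[ T₁ ] ∃[ T₂ ] (InTree G T₁ v × OutTree G T₂ v × EdgeDisjoint G T₁ T₂)
lemma1 G _ R _ consistent s _ v attractor unique =
  let T₁ , in-tree  , T₁⊆Prefix = spanning-in-tree G (λ e → toℕ e <? s) v attractor
      T₂ , out-tree , T₂⊆Suffix = spanning-out-tree G (λ e → s ≤? toℕ e) v
                                    (unique-attractor-Reach-Suffix G attractor unique consistent)
  in T₁ , T₂ , in-tree , out-tree ,
     λ e e∈T₁ e∈T₂ → <⇒≱ (T₁⊆Prefix e∈T₁) (T₂⊆Suffix e∈T₂)
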